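{- Let $\mathcal{L}$ be a finite bounded lattice with least element $\hat 0$ and greatest element $\hat 1$, let $x \in \mathcal{L}\setminus\{\hat 0,\hat 1\}$, and let $P = \mathcal{L}\setminus \mathrm{Co}_{\mathcal{L}}(x)$, where $\mathrm{Co}_{\mathcal{L}}(x)=\{y\in\mathcal{L} : x\wedge y=\hat 0 \text{ and } x\vee y=\hat 1\}$ is the set of complements of $x$. Let $\bar P = P\setminus\{\hat 0,\hat 1\}$. Then the order complex $\Delta(\bar P)$ is nonevasive; in particular it is collapsible.
   Context: For a finite poset $Q$, the order complex $\Delta(Q)$ is the abstract simplicial complex on vertex set $Q$ whose faces are the chains (totally ordered subsets) of $Q$. For a simplicial complex $\Delta$ and a vertex $v$, the deletion $\mathrm{dl}_\Delta(v)$ is the subcomplex of faces not containing $v$, and the link $\mathrm{lk}_\Delta(v)$ is the set of faces $\sigma$ with $v\notin\sigma$ and $\sigma\cup\{v\}\in\Delta$. A simplicial complex $\Delta$ on a finite vertex set is nonevasive if either it consists of a single vertex, or there exists a vertex $v$ such that both $\mathrm{dl}_\Delta(v)$ and $\mathrm{lk}_\Delta(v)$ are nonevasive. A simplicial complex is collapsible if it can be reduced to a single point by a sequence of elementary collapses, where an elementary collapse removes a pair of faces $\sigma\subsetneq\tau$ such that $\sigma$ is a proper face of exactly one face, namely $\tau$. -}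

module Defs where

open import Level using (0ℓ)
open import Data.Nat using (ℕ)
open import Data.Fin using (Fin)
open import Data.Fin.Subset using (Subset; ⁅_⁆; _∈_; _∉_; _⊆_; _⊂_)
open import Data.Product using (_×_; Σ)
open import Data.Sum using (_⊎_)
open import Data.Vec using (_[_]≔_)
open import Data.Bool using (true)
open import Relation.Nullary using (¬_)
open import Relation.Binary using (Rel)
open import Relation.Binary.PropositionalEquality using (_≡_; _≢_)
open import Function.Bundles using (_⇔_)

-- A (finite) simplicial complex on the vertex universe Fin n, given by the
-- predicate "σ is a face".  Faces are subsets of Fin n.
Complex : ℕ → Set₁
Complex n = Subset n → Set

module _ {n : ℕ} where

  insert : Fin n → Subset n → Subset n
  insert v σ = σ [ v ]≔ true

  dl : Complex n → Fin n → Complex n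
  dl Δ v σ = Δ σ × v ∉ σ

  lk : Complex n → Fin n → Complex n
  lk Δ v σ = v ∉ σ × Δ (insert v σ)

  IsPoint : Complex n → Fin n → Set
  IsPoint Δ v = ∀ σ → Δ σ ⇔ (σ ⊆ ⁅ v ⁆)

  data Nonevasive (Δ : Complex n) : Set₁ where
    point : (v : Fin n) → IsPoint Δ v → Nonevasive Δ
    split : (v : Fin n) → Δ ⁅ v ⁆ →
            Nonevasive (dl Δ v) → Nonevasive (lk Δ v) → Nonevasive Δ

  removePair : Complex n → Subset n → Subset n → Complex n
  removePair Δ σ τ ρ = Δ ρ × ρ ≢ σ × ρ ≢ τ

  data Collapsible (Δ : Complex n) : Set₁ where
    point    : (v : Fin n) → IsPoint Δ v → Collapsible Δ
    collapse : (σ τ : Subset n) → Δ σ → Δ τ → σ ⊂ τ →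
               (∀ ρ → Δ ρ → σ ⊂ ρ → ρ ≡ τ) →
               Collapsible (removePair Δ σ τ) → Collapsible Δ

  OrderComplex : Rel (Fin n) 0ℓ → (Fin n → Set) → Complex n
  OrderComplex _≤_ Q σ =
    (∀ a → a ∈ σ → Q a) × (∀ a b → a ∈ σ → b ∈ σ → (a ≤ b) ⊎ (b ≤ a))

  IsComplement : (_∨_ _∧_ : Fin n → Fin n → Fin n) (⊤ ⊥ : Fin n) → Fin n → Fin n → Set
  IsComplement _∨_ _∧_ ⊤ ⊥ x y = (x ∧ y ≡ ⊥) × (x ∨ y ≡ ⊤)

  PBar : (_∨_ _∧_ : Fin n → Fin n → Fin n) (⊤ ⊥ : Fin n) → Fin n → Fin n → Set
  PBar _∨_ _∧_ ⊤ ⊥ x y = ¬ IsComplement _∨_ _∧_ ⊤ ⊥ x y × y ≢ ⊥ × y ≢ ⊤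

-- Deleting v from Δ(R) leaves Δ(R − v), and the link of v is Δ(R_{<v} ∪ R_{>v}). If some c ∈ R
-- has w ∧ c ∈ R for all w ∈ R, then Δ(R) is nonevasive: delete an element v ≰ c (its link has the
-- same property with v ∧ c), and once every element lies below c, Δ(R) is a cone with apex c.
-- In P̄, delete the elements y with y ∧ x = 0̂ one at a time, always a maximal one. As y is not a
-- complement of x, x ∨ y ≠ 1̂, so x ∨ y lies in the link of y, and maximality of y puts w ∧ (x ∨ y)
-- into that link for every w > y. What remains are the elements meeting x, closed under ∧ x.
-- Nonevasive complexes are collapsible: collapses of lk(v) lift to collapses of the cone over it,
-- and once the link is a single vertex w, collapsing {v} ⊂ {v, w} leaves dl(v).

module Submission where

open import Defs
open import Level using (0ℓ)
open import Data.Nat using (ℕ)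
open import Data.Fin using (Fin; _≟_)
open import Data.Fin.Subset using (Subset; ⁅_⁆; _∈_; _∉_; _⊆_; _⊂_; inside; outside) renaming (⊥ to ∅)
open import Data.Fin.Subset.Properties using (_∈?_; ∉⊥; x∈⁅x⁆; x∈⁅y⁆⇒x≡y; ⊆-antisym; ⊆-min; ⊂-irref)
open import Data.Product using (_×_; _,_; proj₁; proj₂; ∃-syntax)
open import Data.Sum using (_⊎_; inj₁; inj₂; [_,_]; swap)
open import Data.Fin.Properties using (any?)
open import Data.Vec using (_[_]≔_; lookup; tabulate)
open import Data.Vec.Properties
  using ([]=⇒lookup; lookup⇒[]=; []=-injective; lookup∘update′; lookup∘tabulate;
         []≔-updates; []≔-minimal; []≔-idempotent; []≔-lookup)
open import Induction.WellFounded using (Acc; acc)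
open import Data.Fin.Subset.Induction using (⊂-wellFounded)
open import Function using (_∘_; Equivalence; mk⇔)
open import Relation.Nullary using (¬_; yes; no; does; contradiction)
open import Relation.Nullary.Decidable using (dec-true; _×-dec_; _⊎-dec_; ¬?; decidable-stable)
open import Relation.Unary using (Pred; Decidable; _≐_)
open import Relation.Binary using (Rel)
open import Relation.Binary.Structures using (IsDecPartialOrder)
open import Relation.Binary.Lattice.Structures using (IsMeetSemilattice; IsBoundedLattice)
open import Relation.Binary.Lattice.Bundles using (MeetSemilattice; BoundedLattice)
import Relation.Binary.Lattice.Properties.BoundedLattice as BoundedLatticeProperties
import Relation.Binary.Lattice.Properties.MeetSemilattice as MeetSemilatticeProperties
open import Relation.Unary.Properties using (≐-refl; ≐-sym; ≐-trans)
open import Relation.Binary.PropositionalEquality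
  using (_≡_; _≢_; refl; sym; trans; cong; subst; module ≡-Reasoning)

module _ {n : ℕ} where

  remove : Fin n → Subset n → Subset n
  remove v ρ = ρ [ v ]≔ outside

  ∈-[]≔⁻ : ∀ {a v s} {σ : Subset n} → a ≢ v → a ∈ σ [ v ]≔ s → a ∈ σ
  ∈-[]≔⁻ {a} {v} {s} {σ} a≢v a∈ =
    lookup⇒[]= a σ (trans (sym (lookup∘update′ a≢v σ s)) ([]=⇒lookup a∈))

  ∈-insert-self : ∀ v {σ : Subset n} → v ∈ insert v σ
  ∈-insert-self v {σ} = []≔-updates σ v

  ∈-insert⁺ : ∀ {a} v {σ : Subset n} → a ∈ σ → a ∈ insert v σ
  ∈-insert⁺ {a} v {σ} a∈σ with a ≟ v
  ... | yes refl = ∈-insert-self v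
  ... | no a≢v = []≔-minimal σ a v a≢v a∈σ

  ∈-insert⁻ : ∀ {a} v {σ : Subset n} → a ∈ insert v σ → a ≡ v ⊎ a ∈ σ
  ∈-insert⁻ {a} v a∈ with a ≟ v
  ... | yes a≡v = inj₁ a≡v
  ... | no a≢v = inj₂ (∈-[]≔⁻ a≢v a∈)

  ∉-remove-self : ∀ v {ρ : Subset n} → v ∉ remove v ρ
  ∉-remove-self v {ρ} v∈ with () ← []=-injective ([]≔-updates ρ v) v∈

  ∈-remove⁺ : ∀ {a v} {ρ : Subset n} → a ∈ ρ → a ≢ v → a ∈ remove v ρ
  ∈-remove⁺ {a} {v} {ρ} a∈ρ a≢v = []≔-minimal ρ a v a≢v a∈ρ

  insert-remove : ∀ {v} {ρ : Subset n} → v ∈ ρ → insert v (remove v ρ) ≡ ρ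
  insert-remove {v} {ρ} v∈ρ = begin
    (ρ [ v ]≔ outside) [ v ]≔ inside  ≡⟨ []≔-idempotent ρ v ⟩
    ρ [ v ]≔ inside                   ≡⟨ cong (ρ [ v ]≔_) ([]=⇒lookup v∈ρ) ⟨
    ρ [ v ]≔ lookup ρ v               ≡⟨ []≔-lookup ρ v ⟩
    ρ                                 ∎
    where open ≡-Reasoning

  insert-injective : ∀ {v} {σ τ : Subset n} → v ∉ σ → v ∉ τ → insert v σ ≡ insert v τ → σ ≡ τ
  insert-injective v∉σ v∉τ eq = ⊆-antisym (⊆-from v∉σ eq) (⊆-from v∉τ (sym eq))
    where
    ⊆-from : ∀ {v} {σ τ : Subset n} → v ∉ σ → insert v σ ≡ insert v τ → σ ⊆ τ
    ⊆-from {v} v∉σ eq {a} a∈σ =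
      ∈-[]≔⁻ (λ { refl → v∉σ a∈σ }) (subst (a ∈_) eq (∈-insert⁺ v a∈σ))

  insert-⊂ : ∀ {v} {σ τ : Subset n} → v ∉ τ → σ ⊂ τ → insert v σ ⊂ insert v τ
  insert-⊂ {v} {σ} {τ} v∉τ (σ⊆τ , a , a∈τ , a∉σ) = insert-⊆ , a , ∈-insert⁺ v a∈τ , a∉
    where
    insert-⊆ : insert v σ ⊆ insert v τ
    insert-⊆ b∈ = [ (λ { refl → ∈-insert-self v }) , ∈-insert⁺ v ∘ σ⊆τ ] (∈-insert⁻ v b∈)
    a∉ : a ∉ insert v σ
    a∉ a∈ = [ (λ { refl → v∉τ a∈τ }) , a∉σ ] (∈-insert⁻ v a∈)

  remove-⊂ : ∀ {v} {σ ρ : Subset n} → v ∉ σ → insert v σ ⊂ ρ → σ ⊂ remove v ρ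
  remove-⊂ {v} v∉σ (σ⊆ρ , a , a∈ρ , a∉) =
    (λ b∈σ → ∈-remove⁺ (σ⊆ρ (∈-insert⁺ v b∈σ)) (λ { refl → v∉σ b∈σ }))
    , a , ∈-remove⁺ a∈ρ (λ { refl → a∉ (∈-insert-self v) }) , a∉ ∘ ∈-insert⁺ v

  ⊆⁅⁆⇒≡∅⊎≡⁅⁆ : ∀ {w} {ρ : Subset n} → ρ ⊆ ⁅ w ⁆ → ρ ≡ ∅ ⊎ ρ ≡ ⁅ w ⁆
  ⊆⁅⁆⇒≡∅⊎≡⁅⁆ {w} {ρ} ρ⊆ with w ∈? ρ
  ... | yes w∈ρ = inj₂ (⊆-antisym ρ⊆ (λ a∈ → subst (_∈ ρ) (sym (x∈⁅y⁆⇒x≡y w a∈)) w∈ρ))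
  ... | no w∉ρ = inj₁ (⊆-antisym (λ a∈ → contradiction (subst (_∈ ρ) (x∈⁅y⁆⇒x≡y w (ρ⊆ a∈)) a∈) w∉ρ)
                                 (⊆-min ρ))

  IsPoint-resp : ∀ {Δ Γ : Complex n} {v} → Δ ≐ Γ → IsPoint Δ v → IsPoint Γ v
  IsPoint-resp (Δ⊆Γ , Γ⊆Δ) Δ-point σ =
    mk⇔ (Equivalence.to (Δ-point σ) ∘ Γ⊆Δ) (Δ⊆Γ ∘ Equivalence.from (Δ-point σ))

  dl-resp : ∀ {Δ Γ : Complex n} {v} → Δ ≐ Γ → dl Δ v ≐ dl Γ v
  dl-resp (Δ⊆Γ , Γ⊆Δ) = (λ (Δσ , v∉σ) → Δ⊆Γ Δσ , v∉σ) , (λ (Γσ , v∉σ) → Γ⊆Δ Γσ , v∉σ)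

  lk-resp : ∀ {Δ Γ : Complex n} {v} → Δ ≐ Γ → lk Δ v ≐ lk Γ v
  lk-resp (Δ⊆Γ , Γ⊆Δ) = (λ (v∉σ , Δσ) → v∉σ , Δ⊆Γ Δσ) , (λ (v∉σ , Γσ) → v∉σ , Γ⊆Δ Γσ)

  removePair-resp : ∀ {Δ Γ : Complex n} {σ τ} → Δ ≐ Γ → removePair Δ σ τ ≐ removePair Γ σ τ
  removePair-resp (Δ⊆Γ , Γ⊆Δ) =
    (λ (Δρ , ρ≢σ , ρ≢τ) → Δ⊆Γ Δρ , ρ≢σ , ρ≢τ) , (λ (Γρ , ρ≢σ , ρ≢τ) → Γ⊆Δ Γρ , ρ≢σ , ρ≢τ)

  Nonevasive-resp : ∀ {Δ Γ : Complex n} → Δ ≐ Γ → Nonevasive Δ → Nonevasive Γ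
  Nonevasive-resp Δ≐Γ (point v Δ-point) = point v (IsPoint-resp Δ≐Γ Δ-point)
  Nonevasive-resp Δ≐Γ (split v Δv dlΔ lkΔ) =
    split v (proj₁ Δ≐Γ Δv) (Nonevasive-resp (dl-resp Δ≐Γ) dlΔ) (Nonevasive-resp (lk-resp Δ≐Γ) lkΔ)

  Collapsible-resp : ∀ {Δ Γ : Complex n} → Δ ≐ Γ → Collapsible Δ → Collapsible Γ
  Collapsible-resp Δ≐Γ (point v Δ-point) = point v (IsPoint-resp Δ≐Γ Δ-point)
  Collapsible-resp Δ≐Γ@(Δ⊆Γ , Γ⊆Δ) (collapse σ τ Δσ Δτ σ⊂τ free rest) =
    collapse σ τ (Δ⊆Γ Δσ) (Δ⊆Γ Δτ) σ⊂τ (λ ρ → free ρ ∘ Γ⊆Δ) (Collapsible-resp (removePair-resp Δ≐Γ) rest)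

  IsFreePair : Complex n → Subset n → Subset n → Set
  IsFreePair Δ σ τ = Δ σ × Δ τ × σ ⊂ τ × (∀ ρ → Δ ρ → σ ⊂ ρ → ρ ≡ τ)

  collapse-at : ∀ {Δ : Complex n} {σ τ} → IsFreePair Δ σ τ → Collapsible (removePair Δ σ τ) → Collapsible Δ
  collapse-at (Δσ , Δτ , σ⊂τ , free) = collapse _ _ Δσ Δτ σ⊂τ free

  IsFreePair-point : ∀ {Δ : Complex n} {w} → IsPoint Δ w → IsFreePair Δ ∅ ⁅ w ⁆
  IsFreePair-point {w = w} Δ-point =
    Equivalence.from (Δ-point ∅) (⊆-min ⁅ w ⁆) , Equivalence.from (Δ-point ⁅ w ⁆) (λ a∈ → a∈)
    , (⊆-min ⁅ w ⁆ , w , x∈⁅x⁆ w , ∉⊥) , free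
    where
    free : ∀ ρ → _ → ∅ ⊂ ρ → ρ ≡ ⁅ w ⁆
    free ρ Δρ ∅⊂ρ with ⊆⁅⁆⇒≡∅⊎≡⁅⁆ (Equivalence.to (Δ-point ρ) Δρ)
    ... | inj₁ refl = contradiction ∅⊂ρ (⊂-irref refl)
    ... | inj₂ ρ≡⁅w⁆ = ρ≡⁅w⁆

  IsFreePair-cone : ∀ {Δ L : Complex n} {v σ τ} → lk Δ v ≐ L → IsFreePair L σ τ →
                    IsFreePair Δ (insert v σ) (insert v τ)
  IsFreePair-cone {Δ} {v = v} {σ} {τ} (lk⊆L , L⊆lk) (Lσ , Lτ , σ⊂τ , free) =
    proj₂ (L⊆lk Lσ) , proj₂ (L⊆lk Lτ) , insert-⊂ (proj₁ (L⊆lk Lτ)) σ⊂τ , cone-free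
    where
    cone-free : ∀ ρ → Δ ρ → insert v σ ⊂ ρ → ρ ≡ insert v τ
    cone-free ρ Δρ vσ⊂ρ = begin
      ρ                      ≡⟨ insert-remove v∈ρ ⟨
      insert v (remove v ρ)  ≡⟨ cong (insert v) (free _ (lk⊆L lk-face) (remove-⊂ v∉σ vσ⊂ρ)) ⟩
      insert v τ             ∎
      where
      open ≡-Reasoning
      v∉σ = proj₁ (L⊆lk Lσ)
      v∈ρ = proj₁ vσ⊂ρ (∈-insert-self v)
      lk-face : lk Δ v (remove v ρ)
      lk-face = ∉-remove-self v , subst Δ (sym (insert-remove v∈ρ)) Δρ

  lk-removePair-cone : ∀ {Δ : Complex n} {v σ τ} → v ∉ σ → v ∉ τ →
                       lk (removePair Δ (insert v σ) (insert v τ)) v ≐ removePair (lk Δ v) σ τ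
  lk-removePair-cone v∉σ v∉τ =
    (λ (v∉ρ , Δρ , ρ≢σ , ρ≢τ) → (v∉ρ , Δρ) , ρ≢σ ∘ cong (insert _) , ρ≢τ ∘ cong (insert _))
    , (λ ((v∉ρ , Δρ) , ρ≢σ , ρ≢τ) →
         v∉ρ , Δρ , ρ≢σ ∘ insert-injective v∉ρ v∉σ , ρ≢τ ∘ insert-injective v∉ρ v∉τ)

  dl-removePair : ∀ {Δ : Complex n} {v σ τ} → v ∈ σ → v ∈ τ → dl (removePair Δ σ τ) v ≐ dl Δ v
  dl-removePair v∈σ v∈τ =
    (λ ((Δρ , _) , v∉ρ) → Δρ , v∉ρ)
    , (λ (Δρ , v∉ρ) → (Δρ , (λ { refl → v∉ρ v∈σ }) , (λ { refl → v∉ρ v∈τ })) , v∉ρ)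

  dl-emptyLink : ∀ {Δ : Complex n} {v} → (∀ σ → ¬ lk Δ v σ) → Δ ≐ dl Δ v
  dl-emptyLink {Δ} {v} lk-empty = (λ {ρ} Δρ → Δρ , v∉ Δρ) , proj₁
    where
    v∉ : ∀ {ρ} → Δ ρ → v ∉ ρ
    v∉ {ρ} Δρ v∈ρ = lk-empty (remove v ρ) (∉-remove-self v , subst Δ (sym (insert-remove v∈ρ)) Δρ)

  collapsible-cone : ∀ {L : Complex n} → Collapsible L →
                     ∀ {Δ v} → lk Δ v ≐ L → Collapsible (dl Δ v) → Collapsible Δ
  collapsible-cone (point w L-point) {Δ} {v} lk≐L dlΔ =
    collapse-at (IsFreePair-cone lk≐L L-pair) (Collapsible-resp dlΔ≐Δ′ dlΔ)
    where
    L-pair = IsFreePair-point L-point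
    Δ′ = removePair Δ (insert v ∅) (insert v ⁅ w ⁆)
    lk≐ : lk Δ′ v ≐ removePair (lk Δ v) ∅ ⁅ w ⁆
    lk≐ = lk-removePair-cone {Δ} (proj₁ (proj₂ lk≐L (proj₁ L-pair)))
                                 (proj₁ (proj₂ lk≐L (proj₁ (proj₂ L-pair))))
    lk-empty : ∀ ρ → ¬ lk Δ′ v ρ
    lk-empty ρ lkρ with proj₁ (removePair-resp lk≐L) (proj₁ lk≐ lkρ)
    ... | Lρ , ρ≢∅ , ρ≢⁅w⁆ = [ ρ≢∅ , ρ≢⁅w⁆ ] (⊆⁅⁆⇒≡∅⊎≡⁅⁆ (Equivalence.to (L-point ρ) Lρ))
    dlΔ≐Δ′ : dl Δ v ≐ Δ′
    dlΔ≐Δ′ = ≐-sym (≐-trans (dl-emptyLink lk-empty) (dl-removePair {Δ} (∈-insert-self v) (∈-insert-self v)))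
  collapsible-cone (collapse σ τ Lσ Lτ σ⊂τ free L′) {Δ} {v} lk≐L dlΔ =
    collapse-at (IsFreePair-cone lk≐L (Lσ , Lτ , σ⊂τ , free))
      (collapsible-cone L′ (≐-trans (lk-removePair-cone {Δ} v∉σ v∉τ) (removePair-resp lk≐L))
        (Collapsible-resp (≐-sym (dl-removePair {Δ} (∈-insert-self v) (∈-insert-self v))) dlΔ))
    where
    v∉σ = proj₁ (proj₂ lk≐L Lσ)
    v∉τ = proj₁ (proj₂ lk≐L Lτ)

  Nonevasive⇒Collapsible : ∀ {Δ : Complex n} → Nonevasive Δ → Collapsible Δ
  Nonevasive⇒Collapsible (point v Δ-point) = point v Δ-point
  Nonevasive⇒Collapsible (split v _ dlΔ lkΔ) =
    collapsible-cone (Nonevasive⇒Collapsible lkΔ) ≐-refl (Nonevasive⇒Collapsible dlΔ)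

  -- Recursion over decidable predicates is well-founded recursion on ⊂ of their supports.
  support : {R : Pred (Fin n) 0ℓ} → Decidable R → Subset n
  support R? = tabulate (does ∘ R?)

  ∈-support⁺ : ∀ {R : Pred (Fin n) 0ℓ} (R? : Decidable R) {a} → R a → a ∈ support R?
  ∈-support⁺ R? {a} Ra = lookup⇒[]= a _ (trans (lookup∘tabulate (does ∘ R?) a) (dec-true (R? a) Ra))

  ∈-support⁻ : ∀ {R : Pred (Fin n) 0ℓ} (R? : Decidable R) {a} → a ∈ support R? → R a
  ∈-support⁻ R? {a} a∈ with R? a | trans (sym (lookup∘tabulate (does ∘ R?) a)) ([]=⇒lookup a∈)
  ... | yes Ra | _ = Ra
  ... | no _ | ()

  support-⊂ : ∀ {R Q : Pred (Fin n) 0ℓ} (R? : Decidable R) (Q? : Decidable Q) {a} →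
              (∀ {b} → R b → Q b) → Q a → ¬ R a → support R? ⊂ support Q?
  support-⊂ R? Q? R⊆Q Qa ¬Ra =
    ∈-support⁺ Q? ∘ R⊆Q ∘ ∈-support⁻ R? , _ , ∈-support⁺ Q? Qa , ¬Ra ∘ ∈-support⁻ R?

module DecPoset {n : ℕ} {_⊑_ : Rel (Fin n) 0ℓ} (isDecPartialOrder : IsDecPartialOrder _≡_ _⊑_) where
  open IsDecPartialOrder isDecPartialOrder
    using (antisym; reflexive) renaming (refl to ⊑-refl; trans to ⊑-trans)
  open IsDecPartialOrder isDecPartialOrder public using () renaming (_≤?_ to _⊑?_)

  Δ : Pred (Fin n) 0ℓ → Complex n
  Δ = OrderComplex _⊑_

  dlᵖ : Pred (Fin n) 0ℓ → Fin n → Pred (Fin n) 0ℓ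
  dlᵖ R v w = R w × w ≢ v

  lkᵖ : Pred (Fin n) 0ℓ → Fin n → Pred (Fin n) 0ℓ
  lkᵖ R v w = dlᵖ R v w × (w ⊑ v ⊎ v ⊑ w)

  dlᵖ? : ∀ {R} → Decidable R → ∀ v → Decidable (dlᵖ R v)
  dlᵖ? R? v w = R? w ×-dec ¬? (w ≟ v)

  lkᵖ? : ∀ {R} → Decidable R → ∀ v → Decidable (lkᵖ R v)
  lkᵖ? R? v w = dlᵖ? R? v w ×-dec (w ⊑? v ⊎-dec v ⊑? w)

  dlᵖ-⊂ : ∀ {R} (R? : Decidable R) {v} → R v → support (dlᵖ? R? v) ⊂ support R?
  dlᵖ-⊂ R? {v} Rv = support-⊂ (dlᵖ? R? v) R? proj₁ Rv (λ (_ , v≢v) → v≢v refl)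

  lkᵖ-⊂ : ∀ {R} (R? : Decidable R) {v} → R v → support (lkᵖ? R? v) ⊂ support R?
  lkᵖ-⊂ R? {v} Rv = support-⊂ (lkᵖ? R? v) R? (proj₁ ∘ proj₁) Rv (λ ((_ , v≢v) , _) → v≢v refl)

  dl-Δ : ∀ {R v} → dl (Δ R) v ≐ Δ (dlᵖ R v)
  dl-Δ = (λ ((⊆R , chain) , v∉σ) → (λ a a∈ → ⊆R a a∈ , λ { refl → v∉σ a∈ }) , chain)
       , (λ (⊆dlᵖ , chain) → ((λ a a∈ → proj₁ (⊆dlᵖ a a∈)) , chain) , (λ v∈ → proj₂ (⊆dlᵖ _ v∈) refl))

  lk-Δ : ∀ {R v} → R v → lk (Δ R) v ≐ Δ (lkᵖ R v)
  lk-Δ {R} {v} Rv = to , from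
    where
    to : ∀ {σ} → lk (Δ R) v σ → Δ (lkᵖ R v) σ
    to (v∉σ , ⊆R , chain) =
      (λ a a∈ → (⊆R a (∈-insert⁺ v a∈) , λ { refl → v∉σ a∈ }) , chain a v (∈-insert⁺ v a∈) (∈-insert-self v))
      , (λ a b a∈ b∈ → chain a b (∈-insert⁺ v a∈) (∈-insert⁺ v b∈))
    from : ∀ {σ} → Δ (lkᵖ R v) σ → lk (Δ R) v σ
    from {σ} (⊆lkᵖ , chain) = (λ v∈σ → proj₂ (proj₁ (⊆lkᵖ v v∈σ)) refl) , ⊆R , chain′
      where
      ⊆R : ∀ a → a ∈ insert v σ → R a
      ⊆R a a∈ = [ (λ { refl → Rv }) , (λ a∈σ → proj₁ (proj₁ (⊆lkᵖ a a∈σ))) ] (∈-insert⁻ v a∈)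
      chain′ : ∀ a b → a ∈ insert v σ → b ∈ insert v σ → a ⊑ b ⊎ b ⊑ a
      chain′ a b a∈ b∈ with ∈-insert⁻ v a∈ | ∈-insert⁻ v b∈
      ... | inj₁ refl | inj₁ refl = inj₁ ⊑-refl
      ... | inj₁ refl | inj₂ b∈σ  = swap (proj₂ (⊆lkᵖ b b∈σ))
      ... | inj₂ a∈σ  | inj₁ refl = proj₂ (⊆lkᵖ a a∈σ)
      ... | inj₂ a∈σ  | inj₂ b∈σ  = chain a b a∈σ b∈σ

  Δ-⊆⁅⁆ : ∀ {R c σ} → R c → σ ⊆ ⁅ c ⁆ → Δ R σ
  Δ-⊆⁅⁆ {R} {c} Rc σ⊆ =
    (λ a a∈ → subst R (sym (≡c a∈)) Rc) , (λ a b a∈ b∈ → inj₁ (reflexive (trans (≡c a∈) (sym (≡c b∈)))))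
    where
    ≡c : ∀ {a} → a ∈ _ → a ≡ c
    ≡c a∈ = x∈⁅y⁆⇒x≡y c (σ⊆ a∈)

  IsPoint-Δ : ∀ {R c} → R c → (∀ {w} → R w → w ≡ c) → IsPoint (Δ R) c
  IsPoint-Δ {c = c} Rc ≡c σ =
    mk⇔ (λ (⊆R , _) a∈ → subst (_∈ ⁅ c ⁆) (sym (≡c (⊆R _ a∈))) (x∈⁅x⁆ c)) (Δ-⊆⁅⁆ Rc)

  nonevasive-split : ∀ {R v} → R v → Nonevasive (Δ (dlᵖ R v)) → Nonevasive (Δ (lkᵖ R v)) → Nonevasive (Δ R)
  nonevasive-split {v = v} Rv dl-nonevasive lk-nonevasive =
    split v (Δ-⊆⁅⁆ Rv (λ a∈ → a∈))
      (Nonevasive-resp (≐-sym dl-Δ) dl-nonevasive) (Nonevasive-resp (≐-sym (lk-Δ Rv)) lk-nonevasive)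

  nonevasive-withMaximum : ∀ {R} → Decidable R → ∀ {c} → R c → (∀ {w} → R w → w ⊑ c) → Nonevasive (Δ R)
  nonevasive-withMaximum R? = go R? (⊂-wellFounded _)
    where
    go : ∀ {R} (R? : Decidable R) → Acc _⊂_ (support R?) →
         ∀ {c} → R c → (∀ {w} → R w → w ⊑ c) → Nonevasive (Δ R)
    go R? (acc rec) {c} Rc ⊑c with any? (λ v → R? v ×-dec ¬? (v ≟ c))
    ... | no ∄v = point c (IsPoint-Δ Rc (λ {w} Rw → decidable-stable (w ≟ c) (λ w≢c → ∄v (w , Rw , w≢c))))
    ... | yes (v , Rv , v≢c) = nonevasive-split Rv
          (go (dlᵖ? R? v) (rec (dlᵖ-⊂ R? Rv)) (Rc , v≢c ∘ sym) (⊑c ∘ proj₁))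
          (go (lkᵖ? R? v) (rec (lkᵖ-⊂ R? Rv)) ((Rc , v≢c ∘ sym) , inj₂ (⊑c Rv)) (⊑c ∘ proj₁ ∘ proj₁))

  ∃-maximal : ∀ {S : Pred (Fin n) 0ℓ} → Decidable S → ∀ {y₀} → S y₀ →
              ∃[ y ] S y × (∀ {z} → S z → y ⊑ z → z ≡ y)
  ∃-maximal {S} S? = go (⊂-wellFounded _)
    where
    go : ∀ {y} → Acc _⊂_ (support (y ⊑?_)) → S y → ∃[ y ] S y × (∀ {z} → S z → y ⊑ z → z ≡ y)
    go {y} (acc rec) Sy with any? (λ z → S? z ×-dec y ⊑? z ×-dec ¬? (z ≟ y))
    ... | yes (z , Sz , y⊑z , z≢y) =
          go (rec (support-⊂ (z ⊑?_) (y ⊑?_) (⊑-trans y⊑z) ⊑-refl (λ z⊑y → z≢y (antisym z⊑y y⊑z)))) Sz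
    ... | no ∄z = y , Sy , λ {z} Sz y⊑z → decidable-stable (z ≟ y) (λ z≢y → ∄z (z , Sz , y⊑z , z≢y))

module MeetSemilatticeCone {n : ℕ} {_⊑_ : Rel (Fin n) 0ℓ} {_∧_ : Fin n → Fin n → Fin n}
                           (isMeetSemilattice : IsMeetSemilattice _≡_ _⊑_ _∧_) where

  meetSemilattice : MeetSemilattice 0ℓ 0ℓ 0ℓ
  meetSemilattice = record { isMeetSemilattice = isMeetSemilattice }

  open MeetSemilattice meetSemilattice using (x∧y≤x; x∧y≤y) renaming (refl to ⊑-refl; trans to ⊑-trans)
  open MeetSemilatticeProperties meetSemilattice using (∧-comm; ∧-assoc; y≤x⇒x∧y≈y; ≈-dec⇒isDecPartialOrder)
  open DecPoset (≈-dec⇒isDecPartialOrder _≟_)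

  x⊑y⇒x∧y≡x : ∀ {a b} → a ⊑ b → a ∧ b ≡ a
  x⊑y⇒x∧y≡x {a} {b} a⊑b = trans (∧-comm a b) (y≤x⇒x∧y≈y a⊑b)

  nonevasive-meetClosed : ∀ {R} → Decidable R → ∀ {c} → R c → (∀ {w} → R w → R (w ∧ c)) → Nonevasive (Δ R)
  nonevasive-meetClosed R? = go R? (⊂-wellFounded _)
    where
    go : ∀ {R} (R? : Decidable R) → Acc _⊂_ (support R?) →
         ∀ {c} → R c → (∀ {w} → R w → R (w ∧ c)) → Nonevasive (Δ R)
    go {R} R? (acc rec) {c} Rc closed with any? (λ v → R? v ×-dec ¬? (v ⊑? c))
    ... | no ∄v = nonevasive-withMaximum R? Rc
          (λ {w} Rw → decidable-stable (w ⊑? c) (λ w⋢c → ∄v (w , Rw , w⋢c)))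
    ... | yes (v , Rv , v⋢c) = nonevasive-split Rv
          (go (dlᵖ? R? v) (rec (dlᵖ-⊂ R? Rv)) (Rc , c≢v) (λ (Rw , _) → closed Rw , ∧c≢v))
          (go (lkᵖ? R? v) (rec (lkᵖ-⊂ R? Rv)) v∧c∈lkᵖ lkᵖ-closed)
      where
      ∧c≢v : ∀ {w} → w ∧ c ≢ v
      ∧c≢v {w} w∧c≡v = v⋢c (subst (_⊑ c) w∧c≡v (x∧y≤y w c))
      c≢v : c ≢ v
      c≢v refl = v⋢c ⊑-refl
      v∧c∈lkᵖ : lkᵖ R v (v ∧ c)
      v∧c∈lkᵖ = (closed Rv , ∧c≢v) , inj₁ (x∧y≤x v c)
      lkᵖ-closed : ∀ {w} → lkᵖ R v w → lkᵖ R v (w ∧ (v ∧ c))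
      lkᵖ-closed {w} ((Rw , _) , inj₁ w⊑v) =
        subst (lkᵖ R v) w∧c≡w∧v∧c ((closed Rw , ∧c≢v) , inj₁ (⊑-trans (x∧y≤x w c) w⊑v))
        where
        open ≡-Reasoning
        w∧c≡w∧v∧c : w ∧ c ≡ w ∧ (v ∧ c)
        w∧c≡w∧v∧c = begin
          w ∧ c        ≡⟨ cong (_∧ c) (x⊑y⇒x∧y≡x w⊑v) ⟨
          (w ∧ v) ∧ c  ≡⟨ ∧-assoc w v c ⟩
          w ∧ (v ∧ c)  ∎
      lkᵖ-closed {w} (_ , inj₂ v⊑w) = subst (lkᵖ R v) (sym (y≤x⇒x∧y≈y (⊑-trans (x∧y≤x v c) v⊑w))) v∧c∈lkᵖ

module NonComplements {n : ℕ} {_⊑_ : Rel (Fin n) 0ℓ} {_∨_ _∧_ : Fin n → Fin n → Fin n} {⊤ ⊥ : Fin n}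
                       (isBoundedLattice : IsBoundedLattice _≡_ _⊑_ _∨_ _∧_ ⊤ ⊥)
                       (x : Fin n) (x≢⊥ : x ≢ ⊥) (x≢⊤ : x ≢ ⊤) where

  boundedLattice : BoundedLattice 0ℓ 0ℓ 0ℓ
  boundedLattice = record { isBoundedLattice = isBoundedLattice }

  open BoundedLattice boundedLattice
    using (isMeetSemilattice; meetSemilattice; antisym; maximum; x∧y≤y; ∧-greatest; x≤x∨y; y≤x∨y)
    renaming (trans to ⊑-trans)
  open BoundedLatticeProperties boundedLattice using (∧-zeroˡ)
  open MeetSemilatticeProperties meetSemilattice
    using (∧-comm; ∧-assoc; ∧-idempotent; y≤x⇒x∧y≈y; ≈-dec⇒isDecPartialOrder)
  open DecPoset (≈-dec⇒isDecPartialOrder _≟_)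
  open MeetSemilatticeCone isMeetSemilattice using (x⊑y⇒x∧y≡x; nonevasive-meetClosed)

  P̄ : Pred (Fin n) 0ℓ
  P̄ = PBar _∨_ _∧_ ⊤ ⊥ x

  P̄? : Decidable P̄
  P̄? y = ¬? ((x ∧ y ≟ ⊥) ×-dec (x ∨ y ≟ ⊤)) ×-dec ¬? (y ≟ ⊥) ×-dec ¬? (y ≟ ⊤)

  Disjoint : Pred (Fin n) 0ℓ
  Disjoint w = w ∧ x ≡ ⊥

  Disjoint? : Decidable Disjoint
  Disjoint? w = w ∧ x ≟ ⊥

  ⊑-≢⊤ : ∀ {a b} → a ⊑ b → b ≢ ⊤ → a ≢ ⊤
  ⊑-≢⊤ {b = b} a⊑b b≢⊤ refl = b≢⊤ (antisym (maximum b) a⊑b)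

  meetsX⇒P̄ : ∀ {w} → ¬ Disjoint w → w ≢ ⊤ → P̄ w
  meetsX⇒P̄ {w} w-meets w≢⊤ =
    (λ (x∧w≡⊥ , _) → w-meets (trans (∧-comm w x) x∧w≡⊥)) , (λ { refl → w-meets (∧-zeroˡ x) }) , w≢⊤

  record Admissible (R : Pred (Fin n) 0ℓ) : Set where
    field
      ⊆P̄ : ∀ {w} → R w → P̄ w
      meetsX⇒∈ : ∀ {w} → P̄ w → ¬ Disjoint w → R w

  P̄-admissible : Admissible P̄
  P̄-admissible = record
    { ⊆P̄ = λ P̄w → P̄w
    ; meetsX⇒∈ = λ P̄w _ → P̄w
    }

  IsMaximalDisjoint : Pred (Fin n) 0ℓ → Fin n → Set
  IsMaximalDisjoint R y = ∀ {z} → R z × Disjoint z → y ⊑ z → z ≡ y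

  dlᵖ-admissible : ∀ {R y} → Admissible R → Disjoint y → Admissible (dlᵖ R y)
  dlᵖ-admissible adm y-disjoint = record
    { ⊆P̄ = ⊆P̄ ∘ proj₁
    ; meetsX⇒∈ = λ P̄w w-meets → meetsX⇒∈ P̄w w-meets , (λ { refl → w-meets y-disjoint })
    }
    where open Admissible adm

  nonevasive-meetsX : ∀ {R} → Decidable R → Admissible R → (∀ {w} → R w → ¬ Disjoint w) → Nonevasive (Δ R)
  nonevasive-meetsX {R} R? adm meets =
    nonevasive-meetClosed R? (meetsX⇒∈ (meetsX⇒P̄ x-meets x≢⊤) x-meets) closed
    where
    open Admissible adm
    x-meets : ¬ Disjoint x
    x-meets = x≢⊥ ∘ trans (sym (∧-idempotent x))
    closed : ∀ {w} → R w → R (w ∧ x)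
    closed {w} Rw = meetsX⇒∈ (meetsX⇒P̄ w∧x-meets (⊑-≢⊤ (x∧y≤y w x) x≢⊤)) w∧x-meets
      where
      w∧x-meets : ¬ Disjoint (w ∧ x)
      w∧x-meets = meets Rw ∘ trans (sym (trans (∧-assoc w x x) (cong (w ∧_) (∧-idempotent x))))

  nonevasive-lkᵖ-maximalDisjoint : ∀ {R y} → Decidable R → Admissible R →
                                   R y → Disjoint y → IsMaximalDisjoint R y → Nonevasive (Δ (lkᵖ R y))
  nonevasive-lkᵖ-maximalDisjoint {R} {y} R? adm Ry y-disjoint maximal =
    nonevasive-meetClosed (lkᵖ? R? y) x∨y∈lkᵖ lkᵖ-closed
    where
    open Admissible adm
    x∨y≢⊤ : x ∨ y ≢ ⊤
    x∨y≢⊤ x∨y≡⊤ = proj₁ (⊆P̄ Ry) (trans (∧-comm x y) y-disjoint , x∨y≡⊤)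
    x∨y∧x≡x : (x ∨ y) ∧ x ≡ x
    x∨y∧x≡x = y≤x⇒x∧y≈y (x≤x∨y x y)
    x∨y-meets : ¬ Disjoint (x ∨ y)
    x∨y-meets = x≢⊥ ∘ trans (sym x∨y∧x≡x)
    x∨y≢y : x ∨ y ≢ y
    x∨y≢y x∨y≡y = x≢⊥ (begin
      x      ≡⟨ x⊑y⇒x∧y≡x (subst (x ⊑_) x∨y≡y (x≤x∨y x y)) ⟨
      x ∧ y  ≡⟨ ∧-comm x y ⟩
      y ∧ x  ≡⟨ y-disjoint ⟩
      ⊥      ∎)
      where open ≡-Reasoning
    x∨y∈lkᵖ : lkᵖ R y (x ∨ y)
    x∨y∈lkᵖ = (meetsX⇒∈ (meetsX⇒P̄ x∨y-meets x∨y≢⊤) x∨y-meets , x∨y≢y) , inj₂ (y≤x∨y x y)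
    lkᵖ-closed : ∀ {w} → lkᵖ R y w → lkᵖ R y (w ∧ (x ∨ y))
    lkᵖ-closed {w} w∈@(_ , inj₁ w⊑y) = subst (lkᵖ R y) (sym (x⊑y⇒x∧y≡x (⊑-trans w⊑y (y≤x∨y x y)))) w∈
    lkᵖ-closed {w} ((Rw , w≢y) , inj₂ y⊑w) with Disjoint? w
    ... | yes w-disjoint = contradiction (maximal (Rw , w-disjoint) y⊑w) w≢y
    ... | no w-meets = (meetsX⇒∈ (meetsX⇒P̄ m-meets (⊑-≢⊤ (x∧y≤y w (x ∨ y)) x∨y≢⊤)) m-meets , m≢y)
                       , inj₂ (∧-greatest y⊑w (y≤x∨y x y))
      where
      m∧x≡w∧x : (w ∧ (x ∨ y)) ∧ x ≡ w ∧ x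
      m∧x≡w∧x = trans (∧-assoc w (x ∨ y) x) (cong (w ∧_) x∨y∧x≡x)
      m-meets : ¬ Disjoint (w ∧ (x ∨ y))
      m-meets = w-meets ∘ trans (sym m∧x≡w∧x)
      m≢y : w ∧ (x ∨ y) ≢ y
      m≢y m≡y = m-meets (trans (cong (_∧ x) m≡y) y-disjoint)

  nonevasive-admissible : ∀ {R} → Decidable R → Admissible R → Nonevasive (Δ R)
  nonevasive-admissible R? = go R? (⊂-wellFounded _)
    where
    go : ∀ {R} (R? : Decidable R) → Acc _⊂_ (support R?) → Admissible R → Nonevasive (Δ R)
    go R? (acc rec) adm with any? (λ w → R? w ×-dec Disjoint? w)
    ... | no ∄w = nonevasive-meetsX R? adm (λ Rw w-disjoint → ∄w (_ , Rw , w-disjoint))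
    ... | yes (_ , Rw-disjoint) with ∃-maximal (λ w → R? w ×-dec Disjoint? w) Rw-disjoint
    ... | y , (Ry , y-disjoint) , maximal = nonevasive-split Ry
            (go (dlᵖ? R? y) (rec (dlᵖ-⊂ R? Ry)) (dlᵖ-admissible adm y-disjoint))
            (nonevasive-lkᵖ-maximalDisjoint R? adm Ry y-disjoint maximal)

  nonevasive-P̄ : Nonevasive (Δ P̄)
  nonevasive-P̄ = nonevasive-admissible P̄? P̄-admissible

theorem2p1 : (n : ℕ) (_≤_ : Rel (Fin n) 0ℓ) (_∨_ _∧_ : Fin n → Fin n → Fin n) (⊤ ⊥ : Fin n) →
    IsBoundedLattice _≡_ _≤_ _∨_ _∧_ ⊤ ⊥ →
    (x : Fin n) → x ≢ ⊥ → x ≢ ⊤ →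
    Nonevasive (OrderComplex _≤_ (PBar _∨_ _∧_ ⊤ ⊥ x))
      × Collapsible (OrderComplex _≤_ (PBar _∨_ _∧_ ⊤ ⊥ x))
theorem2p1 n _≤_ _∨_ _∧_ ⊤ ⊥ isBoundedLattice x x≢⊥ x≢⊤ = nonevasive , Nonevasive⇒Collapsible nonevasive
  where
  nonevasive = NonComplements.nonevasive-P̄ isBoundedLattice x x≢⊥ x≢⊤
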